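{- There is $d_0>0$ such that for every integer $d>d_0$ and every set $A\subseteq\mathcal{L}_d$ (where $\mathcal{L}_j=\{x\subseteq[2d-1]:|x|=j\}$), with $N(A)$ the neighborhood of $A$ in the bipartite graph $B(2d-1,d)$ on $\mathcal{L}_d\cup\mathcal{L}_{d-1}$ with adjacency given by strict inclusion: (i) if $|A|\le d$ then $|N(A)|\ge d|A|-|A|^2/2$; in particular, if $|A|\le d/4$ then $|N(A)|\ge 7d|A|/8$; (ii) if $|A|\le d^6$ then $|N(A)|\ge d|A|/9$; (iii) if $|A|\le\binom{2d-2}{d}$ then $|N(A)|\ge\left(1+\frac{1}{d-1}\right)|A|$.
   Context: $N(A)=\bigcup_{v\in A}N(v)$. -}

module Defs where

open import Data.Nat using (ℕ; zero; suc; _≟_; _∸_)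
open import Data.Bool using (true; false)
open import Data.Vec using (_∷_; [])
open import Data.List using (List; []; _∷_; _++_; map; filter; length)
open import Data.List.Relation.Unary.Any using (Any; any?)
open import Data.Fin.Subset using (Subset; inside; outside; _⊂_; ∣_∣)
open import Data.Fin.Subset.Properties using (_⊂?_)
open import Relation.Nullary using (_×-dec_)
open import Data.Product using (_×_)
open import Relation.Binary.PropositionalEquality using (_≡_)

allSubsets : ∀ n → List (Subset n)
allSubsets zero = [] ∷ []
allSubsets (suc n) = map (outside ∷_) (allSubsets n) ++ map (inside ∷_) (allSubsets n)

N : ∀ {n} → ℕ → List (Subset n) → List (Subset n)
N {n} k A = filter (λ y → (∣ y ∣ ≟ k ∸ 1) ×-dec any? (y ⊂?_) A) (allSubsets n)

-- Part (i) is inclusion-exclusion on facets: every d-set has d subsets of size d - 1, and two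
-- distinct d-sets share at most one of them (their intersection), so the d-sets of A have at least
-- d|A| - C(|A|, 2) distinct facets.
--
-- Parts (ii) and (iii) concern the shadow ∂A = N(A) and come from Lovász's local form of the
-- Kruskal-Katona theorem: for a k-uniform family A and r ≥ 0, if |A| ≤ C(k+r, k) then
-- k|A| ≤ (r+1)|∂A|, and if |A| ≥ C(k+r, k) then |∂A| ≥ C(k+r, k-1). It is proved by induction on k
-- through the links A_v = {x ∈ A : v ∈ x}, so it is stated for families of supersets of a fixed set S,
-- with the shadow taken inside the link of S. If some link is large, the shadow of A contains both
-- the shadow of A_v and the sets x - v (x ∈ A_v), which by induction and Pascal's rule number at
-- least C(k+r, k-1). If all links are small, the ratio bounds for the links add up, by double
-- counting (each x ∈ A lies in k links, each y ∈ ∂A in k - 1), to k(k-1)|A| ≤ (r+1)(k-1)|∂A|.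
-- Then r = d - 2 gives (iii), and r = 8 gives (ii) because d⁶ ≤ C(d+8, 8) as soon as d² ≥ 8!.

module Submission where

open import Defs
open import Data.Bool using (not; if_then_else_)
open import Data.Bool.Properties using (not-involutive) renaming (_≟_ to _≟ᵇ_)
open import Data.Fin using (Fin; zero; suc)
open import Data.Fin.Properties using () renaming (_≟_ to _≟ᶠ_; any? to anyFin?)
open import Data.Fin.Subset using (Subset; inside; outside; ∣_∣; _∈_; _∉_; _⊆_; _⊂_; _∩_) renaming (⊥ to ∅)
open import Data.Fin.Subset.Properties
  using (_∈?_; _⊆?_; _⊂?_; anySubset?; ⊆-refl; ⊆-trans; ⊥⊆; ∣⊥∣≡0; p∩q⊆p; p∩q⊆q; x∈p∩q⁺;
         drop-∷-⊆; out⊂in; s⊂s; p⊂q⇒∣p∣<∣q∣)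
open import Data.List using (List; []; _∷_; _++_; map; length; filter; allFin)
open import Data.List.Properties using (map-tabulate)
open import Data.List.Relation.Unary.All using (All; []; _∷_)
import Data.List.Relation.Unary.All as All
open import Data.List.Relation.Unary.AllPairs using (_∷_)
open import Data.List.Relation.Unary.Any using (Any; here; there; any?)
import Data.List.Relation.Unary.Any as Any
open import Data.List.Membership.Propositional using () renaming (_∈_ to _∈ᴸ_)
open import Data.List.Relation.Unary.Unique.Propositional using (Unique)
open import Data.Nat using (ℕ; zero; suc; _+_; _*_; _∸_; _^_; _≤_; _<_; z≤n; s≤s; _!; _≟_; _≤?_)
open import Data.Nat.Combinatorics using (_C_; nCk+nC[k+1]≡[n+1]C[k+1]; nC1≡n; nCk≡nC[n∸k])
open import Data.Nat.Properties
open import Algebra.Properties.CommutativeSemigroup +-commutativeSemigroup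
  using () renaming (interchange to +-interchange)
open import Algebra.Properties.CommutativeSemigroup *-commutativeSemigroup
  using (x∙yz≈y∙xz; x∙yz≈yx∙z)
open import Data.Nat.Tactic.RingSolver using (solve-∀)
open import Data.Product using (Σ; ∃; _×_; _,_; proj₁; proj₂)
open import Data.Sum using (_⊎_; inj₁; inj₂)
open import Data.Vec using (_∷_; []; here; there)
open import Data.Vec.Properties using (∷-injectiveˡ; ∷-injectiveʳ; ≡-dec)
open import Function using (id; _∘_; case_of_)
open import Level using (0ℓ)
open import Relation.Binary.PropositionalEquality
open import Relation.Nullary using (¬_; Dec; yes; no; does; contradiction; ¬?; _×-dec_)
open import Relation.Unary using (Pred; Decidable)

private variable
  X Y : Set
  n : ℕ

-- Finite sums and counting

∑ : List X → (X → ℕ) → ℕ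
∑ []       f = 0
∑ (x ∷ xs) f = f x + ∑ xs f

∑-mono-≤ : ∀ (xs : List X) {f g : X → ℕ} → (∀ x → f x ≤ g x) → ∑ xs f ≤ ∑ xs g
∑-mono-≤ []       f≤g = z≤n
∑-mono-≤ (x ∷ xs) f≤g = +-mono-≤ (f≤g x) (∑-mono-≤ xs f≤g)

∑-cong : ∀ (xs : List X) {f g : X → ℕ} → (∀ x → f x ≡ g x) → ∑ xs f ≡ ∑ xs g
∑-cong []       f≡g = refl
∑-cong (x ∷ xs) f≡g = cong₂ _+_ (f≡g x) (∑-cong xs f≡g)

∑-zero : ∀ (xs : List X) → ∑ xs (λ _ → 0) ≡ 0
∑-zero []       = refl
∑-zero (x ∷ xs) = ∑-zero xs

∑-distrib-+ : ∀ (xs : List X) (f g : X → ℕ) → ∑ xs (λ x → f x + g x) ≡ ∑ xs f + ∑ xs g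
∑-distrib-+ []       f g = refl
∑-distrib-+ (x ∷ xs) f g =
  trans (cong (f x + g x +_) (∑-distrib-+ xs f g)) (+-interchange (f x) (g x) (∑ xs f) (∑ xs g))

*-distribˡ-∑ : ∀ c (xs : List X) (f : X → ℕ) → ∑ xs (λ x → c * f x) ≡ c * ∑ xs f
*-distribˡ-∑ c []       f = sym (*-zeroʳ c)
*-distribˡ-∑ c (x ∷ xs) f =
  trans (cong (c * f x +_) (*-distribˡ-∑ c xs f)) (sym (*-distribˡ-+ c (f x) (∑ xs f)))

∑-++ : ∀ (xs ys : List X) (f : X → ℕ) → ∑ (xs ++ ys) f ≡ ∑ xs f + ∑ ys f
∑-++ []       ys f = refl
∑-++ (x ∷ xs) ys f = trans (cong (f x +_) (∑-++ xs ys f)) (sym (+-assoc (f x) (∑ xs f) (∑ ys f)))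

∑-map : ∀ (g : X → Y) (xs : List X) (f : Y → ℕ) → ∑ (map g xs) f ≡ ∑ xs (f ∘ g)
∑-map g []       f = refl
∑-map g (x ∷ xs) f = cong (f (g x) +_) (∑-map g xs f)

∑-comm : ∀ (xs : List X) (ys : List Y) (f : X → Y → ℕ) →
         ∑ xs (λ x → ∑ ys (f x)) ≡ ∑ ys (λ y → ∑ xs (λ x → f x y))
∑-comm []       ys f = sym (∑-zero ys)
∑-comm (x ∷ xs) ys f =
  trans (cong (∑ ys (f x) +_) (∑-comm xs ys f)) (sym (∑-distrib-+ ys (f x) _))

∑-allFin-suc : ∀ (f : Fin (suc n) → ℕ) → ∑ (allFin (suc n)) f ≡ f zero + ∑ (allFin n) (f ∘ suc)
∑-allFin-suc {n} f =
  cong (f zero +_) (trans (cong (λ vs → ∑ vs f) (sym (map-tabulate id suc))) (∑-map suc (allFin n) f))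

-- Only `does` is inspected, so counts of deciders with the same boolean part agree definitionally.
𝟙 : {P : Set} → Dec P → ℕ
𝟙 d = if does d then 1 else 0

count : {P : Pred X 0ℓ} → Decidable P → List X → ℕ
count P? xs = ∑ xs (λ x → 𝟙 (P? x))

count-mono : {P Q : Pred X 0ℓ} (P? : Decidable P) (Q? : Decidable Q) (xs : List X) →
             (∀ {x} → P x → Q x) → count P? xs ≤ count Q? xs
count-mono P? Q? xs P⇒Q = ∑-mono-≤ xs 𝟙-mono
  where
  𝟙-mono : ∀ x → 𝟙 (P? x) ≤ 𝟙 (Q? x)
  𝟙-mono x with P? x | Q? x
  ... | no _  | _     = z≤n
  ... | yes _ | yes _ = ≤-refl
  ... | yes p | no ¬q = contradiction (P⇒Q p) ¬q

count-cong : {P Q : Pred X 0ℓ} (P? : Decidable P) (Q? : Decidable Q) (xs : List X) →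
             (∀ {x} → P x → Q x) → (∀ {x} → Q x → P x) → count P? xs ≡ count Q? xs
count-cong P? Q? xs P⇒Q Q⇒P = ≤-antisym (count-mono P? Q? xs P⇒Q) (count-mono Q? P? xs Q⇒P)

count-zero : {P : Pred X 0ℓ} (P? : Decidable P) (xs : List X) → (∀ x → ¬ P x) → count P? xs ≡ 0
count-zero P? xs ¬P = trans (∑-cong xs 𝟙-zero) (∑-zero xs)
  where
  𝟙-zero : ∀ x → 𝟙 (P? x) ≡ 0
  𝟙-zero x with P? x
  ... | yes p = contradiction p (¬P x)
  ... | no _  = refl

count-pos : {P : Pred X 0ℓ} (P? : Decidable P) (xs : List X) → 1 ≤ count P? xs → ∃ P
count-pos P? (x ∷ xs) 1≤count with P? x
... | yes p = x , p
... | no _  = count-pos P? xs 1≤count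

count-disjoint : {P Q R : Pred X 0ℓ} (P? : Decidable P) (Q? : Decidable Q) (R? : Decidable R)
                 (xs : List X) → (∀ {x} → P x → ¬ Q x) → (∀ {x} → P x → R x) → (∀ {x} → Q x → R x) →
                 count P? xs + count Q? xs ≤ count R? xs
count-disjoint P? Q? R? xs P⇒¬Q P⇒R Q⇒R =
  subst (_≤ count R? xs) (∑-distrib-+ xs _ _) (∑-mono-≤ xs 𝟙-disjoint)
  where
  𝟙-disjoint : ∀ x → 𝟙 (P? x) + 𝟙 (Q? x) ≤ 𝟙 (R? x)
  𝟙-disjoint x with P? x | Q? x | R? x
  ... | no _  | no _  | _     = z≤n
  ... | yes p | yes q | _     = contradiction q (P⇒¬Q p)
  ... | yes _ | no _  | yes _ = ≤-refl
  ... | yes p | no _  | no ¬r = contradiction (P⇒R p) ¬r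
  ... | no _  | yes _ | yes _ = ≤-refl
  ... | no _  | yes q | no ¬r = contradiction (Q⇒R q) ¬r

count-union : {P Q R : Pred X 0ℓ} (P? : Decidable P) (Q? : Decidable Q) (R? : Decidable R)
              (xs : List X) → (∀ {x} → R x → P x ⊎ Q x) →
              count R? xs ≤ count P? xs + count Q? xs
count-union P? Q? R? xs R⇒P⊎Q =
  subst (count R? xs ≤_) (∑-distrib-+ xs _ _) (∑-mono-≤ xs 𝟙-union)
  where
  𝟙-union : ∀ x → 𝟙 (R? x) ≤ 𝟙 (P? x) + 𝟙 (Q? x)
  𝟙-union x with R? x | P? x | Q? x
  ... | no _  | _     | _     = z≤n
  ... | yes _ | yes _ | _     = s≤s z≤n
  ... | yes _ | no _  | yes _ = ≤-refl
  ... | yes r | no ¬p | no ¬q with R⇒P⊎Q r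
  ...   | inj₁ p = contradiction p ¬p
  ...   | inj₂ q = contradiction q ¬q

⊆⇒≡⊎⊂ : {p q : Subset n} → p ⊆ q → p ≡ q ⊎ p ⊂ q
⊆⇒≡⊎⊂ {p = []}          {[]}          _   = inj₁ refl
⊆⇒≡⊎⊂ {p = inside ∷ p}  {outside ∷ q} p⊆q with () ← p⊆q here
⊆⇒≡⊎⊂ {p = outside ∷ p} {inside ∷ q}  p⊆q = inj₂ (out⊂in (drop-∷-⊆ p⊆q))
⊆⇒≡⊎⊂ {p = inside ∷ p}  {inside ∷ q}  p⊆q with ⊆⇒≡⊎⊂ (drop-∷-⊆ p⊆q)
... | inj₁ refl = inj₁ refl
... | inj₂ p⊂q  = inj₂ (s⊂s p⊂q)
⊆⇒≡⊎⊂ {p = outside ∷ p} {outside ∷ q} p⊆q with ⊆⇒≡⊎⊂ (drop-∷-⊆ p⊆q)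
... | inj₁ refl = inj₁ refl
... | inj₂ p⊂q  = inj₂ (s⊂s p⊂q)

p⊆q∧∣q∣≤∣p∣⇒p≡q : {p q : Subset n} → p ⊆ q → ∣ q ∣ ≤ ∣ p ∣ → p ≡ q
p⊆q∧∣q∣≤∣p∣⇒p≡q p⊆q ∣q∣≤∣p∣ with ⊆⇒≡⊎⊂ p⊆q
... | inj₁ p≡q = p≡q
... | inj₂ p⊂q = contradiction ∣q∣≤∣p∣ (<⇒≱ (p⊂q⇒∣p∣<∣q∣ p⊂q))

p⊆q∧∣p∣<∣q∣⇒p⊂q : {p q : Subset n} → p ⊆ q → ∣ p ∣ < ∣ q ∣ → p ⊂ q
p⊆q∧∣p∣<∣q∣⇒p⊂q p⊆q ∣p∣<∣q∣ with ⊆⇒≡⊎⊂ p⊆q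
... | inj₁ refl = contradiction ∣p∣<∣q∣ (n≮n _)
... | inj₂ p⊂q  = p⊂q

toggle : Fin n → Subset n → Subset n
toggle zero    (s ∷ p) = not s ∷ p
toggle (suc v) (s ∷ p) = s ∷ toggle v p

toggle-involutive : ∀ (v : Fin n) p → toggle v (toggle v p) ≡ p
toggle-involutive zero    (s ∷ p) = cong (_∷ p) (not-involutive s)
toggle-involutive (suc v) (s ∷ p) = cong (s ∷_) (toggle-involutive v p)

∣toggle∣ : ∀ {v : Fin n} {p} → v ∉ p → ∣ toggle v p ∣ ≡ suc ∣ p ∣
∣toggle∣ {v = zero}  {outside ∷ p} v∉p = refl
∣toggle∣ {v = zero}  {inside ∷ p}  v∉p = contradiction here v∉p
∣toggle∣ {v = suc v} {outside ∷ p} v∉p = ∣toggle∣ (v∉p ∘ there)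
∣toggle∣ {v = suc v} {inside ∷ p}  v∉p = cong suc (∣toggle∣ (v∉p ∘ there))

∈-toggle : ∀ {v : Fin n} {p} → v ∉ p → v ∈ toggle v p
∈-toggle {v = zero}  {outside ∷ p} v∉p = here
∈-toggle {v = zero}  {inside ∷ p}  v∉p = contradiction here v∉p
∈-toggle {v = suc v} {s ∷ p}       v∉p = there (∈-toggle (v∉p ∘ there))

∉-toggle : ∀ {v : Fin n} {p} → v ∈ p → v ∉ toggle v p
∉-toggle {v = zero}  here        ()
∉-toggle {v = suc v} (there v∈p) (there v∈p′) = ∉-toggle v∈p v∈p′

∉-toggle⁻ : ∀ {v : Fin n} {p} → v ∉ toggle v p → v ∈ p
∉-toggle⁻ {v = zero}  {inside ∷ p}  _    = here
∉-toggle⁻ {v = zero}  {outside ∷ p} v∉p′ = contradiction here v∉p′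
∉-toggle⁻ {v = suc v} {s ∷ p}       v∉p′ = there (∉-toggle⁻ (v∉p′ ∘ there))

∈-toggle⁺ : ∀ {v w : Fin n} {p} → w ≢ v → w ∈ p → w ∈ toggle v p
∈-toggle⁺ {v = zero}  {zero}  w≢v _           = contradiction refl w≢v
∈-toggle⁺ {v = zero}  {suc w} w≢v (there w∈p) = there w∈p
∈-toggle⁺ {v = suc v} {zero}  w≢v here        = here
∈-toggle⁺ {v = suc v} {suc w} w≢v (there w∈p) = there (∈-toggle⁺ (w≢v ∘ cong suc) w∈p)

∈-toggle⁻ : ∀ {v w : Fin n} {p} → w ≢ v → w ∈ toggle v p → w ∈ p
∈-toggle⁻ {v = v} {w} {p} w≢v w∈p′ =
  subst (w ∈_) (toggle-involutive v p) (∈-toggle⁺ w≢v w∈p′)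

⊆-toggle : ∀ {v : Fin n} {p} → v ∉ p → p ⊆ toggle v p
⊆-toggle {v = v} v∉p {w} w∈p = ∈-toggle⁺ (λ { refl → v∉p w∈p }) w∈p

⊆-toggle⁻ : ∀ {v : Fin n} {p q} → v ∉ p → p ⊆ toggle v q → p ⊆ q
⊆-toggle⁻ {v = v} v∉p p⊆q′ {w} w∈p = ∈-toggle⁻ (λ { refl → v∉p w∈p }) (p⊆q′ w∈p)

toggle-⊆ : ∀ {v : Fin n} {p q} → p ⊆ q → v ∈ q → toggle v p ⊆ q
toggle-⊆ {v = v} p⊆q v∈q {w} w∈p′ with w ≟ᶠ v
... | yes refl = v∈q
... | no w≢v   = p⊆q (∈-toggle⁻ w≢v w∈p′)

#_ : {P : Pred (Subset n) 0ℓ} → Decidable P → ℕ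
#_ {n} P? = count P? (allSubsets n)

𝟙≤1 : {P : Set} (d : Dec P) → 𝟙 d ≤ 1
𝟙≤1 (yes _) = ≤-refl
𝟙≤1 (no _)  = z≤n

#-split : {P : Pred (Subset (suc n)) 0ℓ} (P? : Decidable P) → # P? ≡ # (P? ∘ (outside ∷_)) + # (P? ∘ (inside ∷_))
#-split {n} P? = trans (∑-++ (map (outside ∷_) (allSubsets n)) _ _)
                       (cong₂ _+_ (∑-map (outside ∷_) (allSubsets n) _) (∑-map (inside ∷_) (allSubsets n) _))

#-toggle : ∀ (v : Fin n) {P : Pred (Subset n) 0ℓ} (P? : Decidable P) → # (P? ∘ toggle v) ≡ # P?
#-toggle zero    P? = trans (#-split (P? ∘ toggle zero))
  (trans (+-comm (# (P? ∘ (inside ∷_))) _) (sym (#-split P?)))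
#-toggle (suc v) P? = trans (#-split (P? ∘ toggle (suc v)))
  (trans (cong₂ _+_ (#-toggle v (P? ∘ (outside ∷_))) (#-toggle v (P? ∘ (inside ∷_)))) (sym (#-split P?)))

#-pos : {P : Pred (Subset n) 0ℓ} (P? : Decidable P) {x : Subset n} → P x → 1 ≤ # P?
#-pos P? {[]} px with P? []
... | yes _  = ≤-refl
... | no ¬px = contradiction px ¬px
#-pos P? {outside ∷ x} px rewrite #-split P? = ≤-trans (#-pos (P? ∘ (outside ∷_)) px) (m≤m+n _ _)
#-pos P? {inside ∷ x}  px rewrite #-split P? = ≤-trans (#-pos (P? ∘ (inside ∷_)) px) (m≤n+m _ _)

#-≤1 : {P : Pred (Subset n) 0ℓ} (P? : Decidable P) (a : Subset n) → (∀ {y} → P y → y ≡ a) → # P? ≤ 1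
#-≤1 P? []            P⇒≡a = +-mono-≤ (𝟙≤1 (P? [])) z≤n
#-≤1 {suc n} P? (outside ∷ a) P⇒≡a rewrite #-split P? =
  +-mono-≤ (#-≤1 (P? ∘ (outside ∷_)) a (λ py → ∷-injectiveʳ (P⇒≡a py)))
           (≤-reflexive (count-zero (P? ∘ (inside ∷_)) (allSubsets n)
                                    (λ y py → case ∷-injectiveˡ (P⇒≡a py) of λ ())))
#-≤1 {suc n} P? (inside ∷ a)  P⇒≡a rewrite #-split P? =
  +-mono-≤ (≤-reflexive (count-zero (P? ∘ (outside ∷_)) (allSubsets n)
                                    (λ y py → case ∷-injectiveˡ (P⇒≡a py) of λ ())))
           (#-≤1 (P? ∘ (inside ∷_)) a (λ py → ∷-injectiveʳ (P⇒≡a py)))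

_≟ₛ_ : (p q : Subset n) → Dec (p ≡ q)
_≟ₛ_ = ≡-dec _≟ᵇ_

_∈ᴸ?_ : (y : Subset n) (A : List (Subset n)) → Dec (y ∈ᴸ A)
y ∈ᴸ? A = any? (y ≟ₛ_) A

#-∈ᴸ : (A : List (Subset n)) → Unique A → # (_∈ᴸ? A) ≡ length A
#-∈ᴸ {n} []      _           = count-zero (_∈ᴸ? []) (allSubsets n) (λ y ())
#-∈ᴸ {n} (b ∷ A) (b∉A ∷ uA) = ≤-antisym upper lower
  where
  upper : # (_∈ᴸ? (b ∷ A)) ≤ suc (length A)
  upper = ≤-trans
    (count-union (_≟ₛ b) (_∈ᴸ? A) (_∈ᴸ? (b ∷ A)) (allSubsets n)
      (λ { (here y≡b) → inj₁ y≡b ; (there y∈A) → inj₂ y∈A }))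
    (+-mono-≤ (#-≤1 (_≟ₛ b) b id) (≤-reflexive (#-∈ᴸ A uA)))
  lower : suc (length A) ≤ # (_∈ᴸ? (b ∷ A))
  lower = ≤-trans
    (+-mono-≤ (#-pos (_≟ₛ b) refl) (≤-reflexive (sym (#-∈ᴸ A uA))))
    (count-disjoint (_≟ₛ b) (_∈ᴸ? A) (_∈ᴸ? (b ∷ A)) (allSubsets n)
      (λ { refl b∈A → All.lookup b∉A b∈A refl }) here there)

_∈_∖_ : Fin n → Subset n → Subset n → Set
v ∈ x ∖ S = v ∈ x × v ∉ S

_∈?_∖_ : (v : Fin n) (x S : Subset n) → Dec (v ∈ x ∖ S)
v ∈? x ∖ S = v ∈? x ×-dec ¬? (v ∈? S)

count-∈∖ : {S x : Subset n} → S ⊆ x → count (_∈? x ∖ S) (allFin n) + ∣ S ∣ ≡ ∣ x ∣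
count-∈∖ {S = []}          {[]}          _   = refl
count-∈∖ {S = inside ∷ S}  {outside ∷ x} S⊆x with () ← S⊆x here
count-∈∖ {S = outside ∷ S} {outside ∷ x} S⊆x =
  trans (cong (_+ ∣ S ∣) (∑-allFin-suc (λ v → 𝟙 (v ∈? (outside ∷ x) ∖ (outside ∷ S)))))
        (count-∈∖ (drop-∷-⊆ S⊆x))
count-∈∖ {S = outside ∷ S} {inside ∷ x}  S⊆x =
  trans (cong (_+ ∣ S ∣) (∑-allFin-suc (λ v → 𝟙 (v ∈? (inside ∷ x) ∖ (outside ∷ S)))))
        (cong suc (count-∈∖ (drop-∷-⊆ S⊆x)))
count-∈∖ {S = inside ∷ S}  {inside ∷ x}  S⊆x =
  trans (cong (_+ suc ∣ S ∣) (∑-allFin-suc (λ v → 𝟙 (v ∈? (inside ∷ x) ∖ (inside ∷ S)))))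
        (trans (+-suc _ ∣ S ∣) (cong suc (count-∈∖ (drop-∷-⊆ S⊆x))))

Uniform : Subset n → ℕ → Pred (Subset n) 0ℓ → Set
Uniform S c A = ∀ {x} → A x → S ⊆ x × ∣ x ∣ ≡ ∣ S ∣ + c

∑-#-∈∖ : {A : Pred (Subset n) 0ℓ} (A? : Decidable A) {S : Subset n} {c : ℕ} → Uniform S c A →
         ∑ (allFin n) (λ v → # (λ x → A? x ×-dec v ∈? x ∖ S)) ≡ c * # A?
∑-#-∈∖ {n} A? {S} {c} unif = begin
  ∑ (allFin n) (λ v → # (λ x → A? x ×-dec v ∈? x ∖ S))
    ≡⟨ ∑-comm (allFin n) (allSubsets n) _ ⟩
  ∑ (allSubsets n) (λ x → count (λ v → A? x ×-dec v ∈? x ∖ S) (allFin n))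
    ≡⟨ ∑-cong (allSubsets n) elements-outside ⟩
  ∑ (allSubsets n) (λ x → c * 𝟙 (A? x))
    ≡⟨ *-distribˡ-∑ c (allSubsets n) _ ⟩
  c * # A? ∎
  where
  open ≡-Reasoning
  elements-outside : ∀ x → count (λ v → A? x ×-dec v ∈? x ∖ S) (allFin n) ≡ c * 𝟙 (A? x)
  elements-outside x with A? x
  ... | no _   = trans (∑-zero (allFin n)) (sym (*-zeroʳ c))
  ... | yes ax = trans
    (+-cancelʳ-≡ ∣ S ∣ _ _ (trans (count-∈∖ (proj₁ (unif ax))) (trans (proj₂ (unif ax)) (+-comm ∣ S ∣ c))))
    (sym (*-identityʳ c))

-- Binomial coefficients

pascal : ∀ n k → suc n C suc k ≡ n C k + n C suc k
pascal n k = sym (nCk+nC[k+1]≡[n+1]C[k+1] n k)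

[k+1]*nC[k+1]+k*nCk≡n*nCk : ∀ n k → suc k * (n C suc k) + k * (n C k) ≡ n * (n C k)
[k+1]*nC[k+1]+k*nCk≡n*nCk zero    zero    = refl
[k+1]*nC[k+1]+k*nCk≡n*nCk zero    (suc k) = cong₂ _+_ (*-zeroʳ (suc (suc k))) (*-zeroʳ (suc k))
[k+1]*nC[k+1]+k*nCk≡n*nCk (suc n) zero    = trans (+-identityʳ _) (trans (+-identityʳ _)
                                              (trans (nC1≡n (suc n)) (sym (*-identityʳ (suc n)))))
[k+1]*nC[k+1]+k*nCk≡n*nCk (suc n) (suc k) = begin
  suc (suc k) * (suc n C suc (suc k)) + suc k * (suc n C suc k)
    ≡⟨ cong₂ (λ u w → suc (suc k) * u + suc k * w) (pascal n (suc k)) (pascal n k) ⟩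
  suc (suc k) * (b + c) + suc k * (a + b)
    ≡⟨ regroup k a b c ⟩
  (suc (suc k) * c + suc k * b) + (suc k * b + k * a) + (a + b)
    ≡⟨ cong₂ (λ u w → u + w + (a + b)) ([k+1]*nC[k+1]+k*nCk≡n*nCk n (suc k))
                                        ([k+1]*nC[k+1]+k*nCk≡n*nCk n k) ⟩
  n * b + n * a + (a + b)
    ≡⟨ collect n a b ⟩
  suc n * (a + b)
    ≡⟨ cong (suc n *_) (pascal n k) ⟨
  suc n * (suc n C suc k) ∎
  where
  open ≡-Reasoning
  a = n C k
  b = n C suc k
  c = n C suc (suc k)
  regroup : ∀ k a b c → suc (suc k) * (b + c) + suc k * (a + b) ≡
                        (suc (suc k) * c + suc k * b) + (suc k * b + k * a) + (a + b)
  regroup = solve-∀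
  collect : ∀ n a b → n * b + n * a + (a + b) ≡ suc n * (a + b)
  collect = solve-∀

[k+1]*[k+r+1]C[k+1]≡[r+1]*[k+r+1]Ck : ∀ k r → suc k * ((k + suc r) C suc k) ≡ suc r * ((k + suc r) C k)
[k+1]*[k+r+1]C[k+1]≡[r+1]*[k+r+1]Ck k r = +-cancelʳ-≡ (k * c) _ _ (begin
  suc k * ((k + suc r) C suc k) + k * c ≡⟨ [k+1]*nC[k+1]+k*nCk≡n*nCk (k + suc r) k ⟩
  (k + suc r) * c                       ≡⟨ *-distribʳ-+ c k (suc r) ⟩
  k * c + suc r * c                     ≡⟨ +-comm (k * c) _ ⟩
  suc r * c + k * c                     ∎)
  where
  open ≡-Reasoning
  c = (k + suc r) C k

[k+1]*[n+1]C[k+1]≡[n+1]*nCk : ∀ n k → suc k * (suc n C suc k) ≡ suc n * (n C k)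
[k+1]*[n+1]C[k+1]≡[n+1]*nCk n k = +-cancelʳ-≡ (k * a) _ _ (begin
  suc k * (suc n C suc k) + k * a         ≡⟨ cong (λ u → suc k * u + k * a) (pascal n k) ⟩
  suc k * (a + b) + k * a                 ≡⟨ regroup k a b ⟩
  suc k * a + (suc k * b + k * a)         ≡⟨ cong (suc k * a +_) ([k+1]*nC[k+1]+k*nCk≡n*nCk n k) ⟩
  suc k * a + n * a                       ≡⟨ collect n k a ⟩
  suc n * a + k * a                       ∎)
  where
  open ≡-Reasoning
  a = n C k
  b = n C suc k
  regroup : ∀ k a b → suc k * (a + b) + k * a ≡ suc k * a + (suc k * b + k * a)
  regroup = solve-∀
  collect : ∀ n k a → suc k * a + n * a ≡ suc n * a + k * a
  collect = solve-∀

n^k≤k!*[n+k]Ck : ∀ n k → n ^ k ≤ k ! * ((n + k) C k)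
n^k≤k!*[n+k]Ck n zero    = ≤-refl
n^k≤k!*[n+k]Ck n (suc k) = begin
  n * n ^ k                                      ≤⟨ *-mono-≤ (m≤m+n n (suc k)) (n^k≤k!*[n+k]Ck n k) ⟩
  (n + suc k) * (k ! * c)                        ≡⟨ cong (_* (k ! * c)) (+-suc n k) ⟩
  suc (n + k) * (k ! * c)                        ≡⟨ x∙yz≈y∙xz (suc (n + k)) (k !) c ⟩
  k ! * (suc (n + k) * c)                        ≡⟨ cong (k ! *_) ([k+1]*[n+1]C[k+1]≡[n+1]*nCk (n + k) k) ⟨
  k ! * (suc k * (suc (n + k) C suc k))          ≡⟨ x∙yz≈yx∙z (k !) (suc k) _ ⟩
  suc k ! * (suc (n + k) C suc k)                ≡⟨ cong (λ m → suc k ! * (m C suc k)) (+-suc n k) ⟨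
  suc k ! * ((n + suc k) C suc k)                ∎
  where
  open ≤-Reasoning
  c = (n + k) C k

d^6≤[d+8]Cd : ∀ d → 8 ! ≤ d * d → d ^ 6 ≤ (d + 8) C d
d^6≤[d+8]Cd d 8!≤d² = *-cancelˡ-≤ (8 !) (begin
  8 ! * d ^ 6                    ≤⟨ *-monoˡ-≤ (d ^ 6) 8!≤d² ⟩
  d * d * d ^ 6                  ≡⟨ *-assoc d d (d ^ 6) ⟩
  d ^ 8                          ≤⟨ n^k≤k!*[n+k]Ck d 8 ⟩
  8 ! * ((d + 8) C 8)            ≡⟨ cong (8 ! *_) (nCk≡nC[n∸k] (m≤n+m 8 d)) ⟩
  8 ! * ((d + 8) C (d + 8 ∸ 8))  ≡⟨ cong (λ m → 8 ! * ((d + 8) C m)) (m+n∸n≡m d 8) ⟩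
  8 ! * ((d + 8) C d)            ∎)
  where open ≤-Reasoning

-- Lovász's shadow bound

Shadow : Subset n → ℕ → Pred (Subset n) 0ℓ → Pred (Subset n) 0ℓ
Shadow S i A y = S ⊆ y × ∣ y ∣ ≡ ∣ S ∣ + i × ∃ λ x → A x × y ⊆ x

shadow? : (S : Subset n) (i : ℕ) {A : Pred (Subset n) 0ℓ} → Decidable A → Decidable (Shadow S i A)
shadow? S i A? y = S ⊆? y ×-dec ∣ y ∣ ≟ ∣ S ∣ + i ×-dec anySubset? (λ x → A? x ×-dec y ⊆? x)

Link : Fin n → Pred (Subset n) 0ℓ → Pred (Subset n) 0ℓ
Link v A x = A x × v ∈ x

link? : (v : Fin n) {A : Pred (Subset n) 0ℓ} → Decidable A → Decidable (Link v A)
link? v A? x = A? x ×-dec v ∈? x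

module _ {S : Subset n} {v : Fin n} {A : Pred (Subset n) 0ℓ} (v∉S : v ∉ S) where

  Uniform-Link : ∀ {c} → Uniform S (suc c) A → Uniform (toggle v S) c (Link v A)
  Uniform-Link {c} unif (ax , v∈x) =
    toggle-⊆ (proj₁ (unif ax)) v∈x ,
    trans (proj₂ (unif ax)) (trans (+-suc ∣ S ∣ c) (cong (_+ c) (sym (∣toggle∣ v∉S))))

  Shadow-Link⇒Shadow : ∀ {i y} → Shadow (toggle v S) i (Link v A) y → Shadow S (suc i) A y × v ∈ y
  Shadow-Link⇒Shadow {i} (S′⊆y , ∣y∣≡ , x , (ax , _) , y⊆x) =
    (⊆-trans (⊆-toggle v∉S) S′⊆y ,
     trans ∣y∣≡ (trans (cong (_+ i) (∣toggle∣ v∉S)) (sym (+-suc ∣ S ∣ i))) ,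
     x , ax , y⊆x) ,
    S′⊆y (∈-toggle v∉S)

  Shadow-delete : ∀ {i y} → Uniform S (suc (suc i)) A → v ∉ y → A (toggle v y) → Shadow S (suc i) A y
  Shadow-delete {i} unif v∉y ay′ =
    ⊆-toggle⁻ v∉S S⊆y′ ,
    suc-injective (trans (sym (∣toggle∣ v∉y)) (trans ∣y′∣≡ (+-suc ∣ S ∣ (suc i)))) ,
    _ , ay′ , ⊆-toggle v∉y
    where
    S⊆y′ = proj₁ (unif ay′)
    ∣y′∣≡ = proj₂ (unif ay′)

Uniform-Shadow : ∀ {S : Subset n} {i} {A : Pred (Subset n) 0ℓ} → Uniform S i (Shadow S i A)
Uniform-Shadow (S⊆y , ∣y∣≡ , _) = S⊆y , ∣y∣≡

ShadowBound : ℕ → ℕ → Set₁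
ShadowBound r i =
  ∀ {n} (S : Subset n) {A : Pred (Subset n) 0ℓ} (A? : Decidable A) → Uniform S (suc i) A →
  (# A? ≤ (i + suc r) C suc i → suc i * # A? ≤ suc r * # shadow? S i A?) ×
  ((i + suc r) C suc i ≤ # A? → (i + suc r) C i ≤ # shadow? S i A?)

shadowBound-zero : ∀ r → ShadowBound r 0
shadowBound-zero r {n} S A? unif = ratio , size
  where
  nonempty : 1 ≤ # A? → 1 ≤ # shadow? S 0 A?
  nonempty 1≤#A with count-pos A? (allSubsets n) 1≤#A
  ... | x , ax = #-pos (shadow? S 0 A?) (⊆-refl , sym (+-identityʳ _) , x , ax , proj₁ (unif ax))
  ratio : # A? ≤ suc r C 1 → 1 * # A? ≤ suc r * # shadow? S 0 A?
  ratio #A≤ with # A? in #A≡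
  ... | zero  = z≤n
  ... | suc a = begin
    1 * suc a   ≡⟨ *-identityˡ (suc a) ⟩
    suc a       ≤⟨ subst (suc a ≤_) (nC1≡n (suc r)) #A≤ ⟩
    suc r       ≡⟨ *-identityʳ (suc r) ⟨
    suc r * 1   ≤⟨ *-monoʳ-≤ (suc r) (nonempty (≤-trans (s≤s z≤n) (≤-reflexive (sym #A≡)))) ⟩
    suc r * # shadow? S 0 A? ∎
    where open ≤-Reasoning
  size : suc r C 1 ≤ # A? → 1 ≤ # shadow? S 0 A?
  size C≤#A = nonempty (≤-trans (s≤s z≤n) (≤-trans (≤-reflexive (sym (nC1≡n (suc r)))) C≤#A))

module _ {r i : ℕ} (ih : ShadowBound r i) {S : Subset n} {A : Pred (Subset n) 0ℓ} (A? : Decidable A)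
         (unif : Uniform S (suc (suc i)) A) where

  large-link : ∀ {v} → v ∉ S → (i + suc r) C suc i ≤ # link? v A? →
               suc (i + suc r) C suc i ≤ # shadow? S (suc i) A?
  large-link {v} v∉S large = begin
    suc m C suc i                    ≡⟨ pascal m i ⟩
    m C i + m C suc i                ≡⟨ +-comm (m C i) _ ⟩
    m C suc i + m C i                ≤⟨ +-mono-≤ (≤-trans large (≤-reflexive (sym #deleted≡#link)))
                                                 (proj₂ (ih (toggle v S) (link? v A?) (Uniform-Link v∉S unif)) large) ⟩
    # deleted? + # D′?               ≤⟨ count-disjoint deleted? D′? (shadow? S (suc i) A?) (allSubsets n)
                                          (λ (v∉y , _) D′y → v∉y (proj₂ (Shadow-Link⇒Shadow v∉S D′y)))
                                          (λ (v∉y , ay′) → Shadow-delete v∉S unif v∉y ay′)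
                                          (proj₁ ∘ Shadow-Link⇒Shadow v∉S) ⟩
    # shadow? S (suc i) A?           ∎
    where
    open ≤-Reasoning
    m = i + suc r
    D′? = shadow? (toggle v S) i (link? v A?)
    deleted? : Decidable (λ y → v ∉ y × A (toggle v y))
    deleted? y = ¬? (v ∈? y) ×-dec A? (toggle v y)
    #deleted≡#link : # deleted? ≡ # link? v A?
    #deleted≡#link = trans (sym (#-toggle v deleted?))
      (count-cong (deleted? ∘ toggle v) (link? v A?) (allSubsets n)
        (λ {y} (v∉y′ , ay″) → subst A (toggle-involutive v y) ay″ , ∉-toggle⁻ v∉y′)
        (λ {y} (ay , v∈y) → ∉-toggle v∈y , subst A (sym (toggle-involutive v y)) ay))

  small-links : (∀ {v} → v ∉ S → # link? v A? < (i + suc r) C suc i) →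
                suc (suc i) * # A? ≤ suc r * # shadow? S (suc i) A?
  small-links small = *-cancelˡ-≤ (suc i) (begin
    suc i * (suc (suc i) * # A?)              ≡⟨ cong (suc i *_) (∑-#-∈∖ A? unif) ⟨
    suc i * ∑ (allFin n) (λ v → # inA? v)     ≡⟨ *-distribˡ-∑ (suc i) (allFin n) _ ⟨
    ∑ (allFin n) (λ v → suc i * # inA? v)     ≤⟨ ∑-mono-≤ (allFin n) (λ v → link-ratio v (v ∈? S)) ⟩
    ∑ (allFin n) (λ v → suc r * # inD? v)     ≡⟨ *-distribˡ-∑ (suc r) (allFin n) _ ⟩
    suc r * ∑ (allFin n) (λ v → # inD? v)     ≡⟨ cong (suc r *_) (∑-#-∈∖ D? Uniform-Shadow) ⟩
    suc r * (suc i * # D?)                    ≡⟨ x∙yz≈y∙xz (suc r) (suc i) (# D?) ⟩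
    suc i * (suc r * # D?)                    ∎)
    where
    open ≤-Reasoning
    D? = shadow? S (suc i) A?
    inA? inD? : (v : Fin n) → Decidable _
    inA? v x = A? x ×-dec v ∈? x ∖ S
    inD? v y = D? y ×-dec v ∈? y ∖ S
    link-ratio : ∀ v → Dec (v ∈ S) → suc i * # inA? v ≤ suc r * # inD? v
    link-ratio v (yes v∈S) = subst (_≤ suc r * # inD? v) (sym (trans
      (cong (suc i *_) (count-zero (inA? v) (allSubsets n) (λ x (_ , _ , v∉S) → v∉S v∈S)))
      (*-zeroʳ (suc i)))) z≤n
    link-ratio v (no v∉S) = begin
      suc i * # inA? v      ≡⟨ cong (suc i *_) #inA≡#link ⟩
      suc i * # link? v A?  ≤⟨ proj₁ (ih (toggle v S) (link? v A?) (Uniform-Link v∉S unif)) (<⇒≤ (small v∉S)) ⟩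
      suc r * # D′?         ≤⟨ *-monoʳ-≤ (suc r) (count-mono D′? (inD? v) (allSubsets n) D′⇒inD) ⟩
      suc r * # inD? v      ∎
      where
      D′? = shadow? (toggle v S) i (link? v A?)
      #inA≡#link : # inA? v ≡ # link? v A?
      #inA≡#link = count-cong (inA? v) (link? v A?) (allSubsets n)
                     (λ (ax , v∈x , _) → ax , v∈x) (λ (ax , v∈x) → ax , v∈x , v∉S)
      D′⇒inD : ∀ {y} → Shadow (toggle v S) i (Link v A) y → Shadow S (suc i) A y × v ∈ y ∖ S
      D′⇒inD D′y = let (Dy , v∈y) = Shadow-Link⇒Shadow v∉S D′y in Dy , v∈y , v∉S

shadowBound-suc : ∀ r i → ShadowBound r i → ShadowBound r (suc i)
shadowBound-suc r i ih S A? unif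
  with anyFin? (λ v → ¬? (v ∈? S) ×-dec (i + suc r) C suc i ≤? # link? v A?)
... | yes (v , v∉S , large) = ratio , λ _ → large-shadow
  where
  large-shadow : (suc i + suc r) C suc i ≤ # shadow? S (suc i) A?
  large-shadow = large-link ih A? unif v∉S large
  ratio : # A? ≤ (suc i + suc r) C suc (suc i) → suc (suc i) * # A? ≤ suc r * # shadow? S (suc i) A?
  ratio #A≤ = begin
    suc (suc i) * # A?                             ≤⟨ *-monoʳ-≤ (suc (suc i)) #A≤ ⟩
    suc (suc i) * ((suc i + suc r) C suc (suc i))  ≡⟨ [k+1]*[k+r+1]C[k+1]≡[r+1]*[k+r+1]Ck (suc i) r ⟩
    suc r * ((suc i + suc r) C suc i)              ≤⟨ *-monoʳ-≤ (suc r) large-shadow ⟩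
    suc r * # shadow? S (suc i) A?                 ∎
    where open ≤-Reasoning
... | no no-large-link = (λ _ → small-shadow) , size
  where
  small : ∀ {v} → v ∉ S → # link? v A? < (i + suc r) C suc i
  small v∉S = ≰⇒> (λ large → no-large-link (_ , v∉S , large))
  small-shadow : suc (suc i) * # A? ≤ suc r * # shadow? S (suc i) A?
  small-shadow = small-links ih A? unif small
  size : (suc i + suc r) C suc (suc i) ≤ # A? → (suc i + suc r) C suc i ≤ # shadow? S (suc i) A?
  size C≤#A = *-cancelˡ-≤ (suc r) (begin
    suc r * ((suc i + suc r) C suc i)              ≡⟨ [k+1]*[k+r+1]C[k+1]≡[r+1]*[k+r+1]Ck (suc i) r ⟨
    suc (suc i) * ((suc i + suc r) C suc (suc i))  ≤⟨ *-monoʳ-≤ (suc (suc i)) C≤#A ⟩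
    suc (suc i) * # A?                             ≤⟨ small-shadow ⟩
    suc r * # shadow? S (suc i) A?                 ∎)
    where open ≤-Reasoning

shadowBound : ∀ r i → ShadowBound r i
shadowBound r zero    = shadowBound-zero r
shadowBound r (suc i) = shadowBound-suc r i (shadowBound r i)

-- Inclusion-exclusion on facets

Facet : ℕ → Subset n → Pred (Subset n) 0ℓ
Facet i b y = ∣ y ∣ ≡ i × y ⊆ b

facet? : (i : ℕ) (b : Subset n) → Decidable (Facet i b)
facet? i b y = ∣ y ∣ ≟ i ×-dec y ⊆? b

#-facet : ∀ i (b : Subset n) → ∣ b ∣ ≡ suc i → suc i ≤ # facet? i b
#-facet i       (outside ∷ b) ∣b∣≡ rewrite #-split (facet? i (outside ∷ b)) =
  ≤-trans (#-facet i b ∣b∣≡) (m≤m+n _ _)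
#-facet zero    (inside ∷ b)  ∣b∣≡ rewrite #-split (facet? zero (inside ∷ b)) =
  +-mono-≤ (#-pos (facet? zero b) (suc-injective ∣b∣≡ , ⊆-refl)) z≤n
#-facet (suc i) (inside ∷ b)  ∣b∣≡ rewrite #-split (facet? (suc i) (inside ∷ b)) =
  +-mono-≤ (#-pos (facet? (suc i) b) (suc-injective ∣b∣≡ , ⊆-refl)) (#-facet i b (suc-injective ∣b∣≡))

#-common-facets≤1 : ∀ i {b x : Subset n} → b ≢ x → ∣ b ∣ ≡ suc i → ∣ x ∣ ≡ suc i →
                    # (λ y → facet? i b y ×-dec facet? i x y) ≤ 1
#-common-facets≤1 i {b} {x} b≢x ∣b∣≡ ∣x∣≡ = #-≤1 (λ y → facet? i b y ×-dec facet? i x y) (b ∩ x) ≡b∩x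
  where
  b≡x : i < ∣ b ∩ x ∣ → b ≡ x
  b≡x i<∣b∩x∣ = p⊆q∧∣q∣≤∣p∣⇒p≡q (subst (_⊆ x) b∩x≡b (p∩q⊆q b x)) (≤-reflexive (trans ∣x∣≡ (sym ∣b∣≡)))
    where
    b∩x≡b : b ∩ x ≡ b
    b∩x≡b = p⊆q∧∣q∣≤∣p∣⇒p≡q (p∩q⊆p b x) (subst (_≤ ∣ b ∩ x ∣) (sym ∣b∣≡) i<∣b∩x∣)
  ∣b∩x∣≤i : ∣ b ∩ x ∣ ≤ i
  ∣b∩x∣≤i = ≮⇒≥ (b≢x ∘ b≡x)
  ≡b∩x : ∀ {y} → Facet i b y × Facet i x y → y ≡ b ∩ x
  ≡b∩x ((∣y∣≡ , y⊆b) , (_ , y⊆x)) =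
    p⊆q∧∣q∣≤∣p∣⇒p≡q (λ w∈y → x∈p∩q⁺ (y⊆b w∈y , y⊆x w∈y))
                    (subst (∣ b ∩ x ∣ ≤_) (sym ∣y∣≡) ∣b∩x∣≤i)

Shadowᴸ : ℕ → List (Subset n) → Pred (Subset n) 0ℓ
Shadowᴸ i A y = Any (λ x → Facet i x y) A

shadowᴸ? : (i : ℕ) (A : List (Subset n)) → Decidable (Shadowᴸ i A)
shadowᴸ? i A y = any? (λ x → facet? i x y) A

#-facets-in-shadow : ∀ i {b : Subset n} (A : List (Subset n)) → All (b ≢_) A → All (λ x → ∣ x ∣ ≡ suc i) A →
                     ∣ b ∣ ≡ suc i → # (λ y → facet? i b y ×-dec shadowᴸ? i A y) ≤ length A
#-facets-in-shadow {n} i {b} []      _            _              _    =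
  ≤-reflexive (count-zero (λ y → facet? i b y ×-dec shadowᴸ? i [] y) (allSubsets n) (λ y ()))
#-facets-in-shadow {n} i {b} (x ∷ A) (b≢x ∷ b∉A) (∣x∣≡ ∷ sizes) ∣b∣≡ =
  ≤-trans (count-union (λ y → facet? i b y ×-dec facet? i x y) (λ y → facet? i b y ×-dec shadowᴸ? i A y)
                       (λ y → facet? i b y ×-dec shadowᴸ? i (x ∷ A) y) (allSubsets n)
                       λ { (fb , here fx) → inj₁ (fb , fx) ; (fb , there sh) → inj₂ (fb , sh) })
          (+-mono-≤ (#-common-facets≤1 i b≢x ∣b∣≡ ∣x∣≡) (#-facets-in-shadow i A b∉A sizes ∣b∣≡))

[n+1]C2≡n+nC2 : ∀ n → suc n C 2 ≡ n + n C 2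
[n+1]C2≡n+nC2 n = trans (pascal n 1) (cong (_+ n C 2) (nC1≡n n))

2*nC2+n≡n*n : ∀ n → 2 * (n C 2) + n ≡ n * n
2*nC2+n≡n*n zero    = refl
2*nC2+n≡n*n (suc n) = begin
  2 * (suc n C 2) + suc n          ≡⟨ cong (λ c → 2 * c + suc n) ([n+1]C2≡n+nC2 n) ⟩
  2 * (n + n C 2) + suc n          ≡⟨ regroup n (n C 2) ⟩
  (2 * (n C 2) + n) + suc (n + n)  ≡⟨ cong (_+ suc (n + n)) (2*nC2+n≡n*n n) ⟩
  n * n + suc (n + n)              ≡⟨ square n ⟩
  suc n * suc n                    ∎
  where
  open ≡-Reasoning
  regroup : ∀ n c → 2 * (n + c) + suc n ≡ (2 * c + n) + suc (n + n)
  regroup = solve-∀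
  square : ∀ n → n * n + suc (n + n) ≡ suc n * suc n
  square = solve-∀

bonferroni : ∀ i (A : List (Subset n)) → Unique A → All (λ x → ∣ x ∣ ≡ suc i) A →
             suc i * length A ≤ # shadowᴸ? i A + length A C 2
bonferroni i []      _           _              = ≤-trans (≤-reflexive (*-zeroʳ (suc i))) z≤n
bonferroni {n} i (b ∷ A) (b∉A ∷ uA) (∣b∣≡ ∷ sizes) = begin
  suc i * suc a                    ≡⟨ *-suc (suc i) a ⟩
  suc i + suc i * a                ≤⟨ +-mono-≤ new-facets (bonferroni i A uA sizes) ⟩
  (# new? + a) + (# old? + a C 2)  ≡⟨ +-interchange (# new?) a (# old?) (a C 2) ⟩
  (# new? + # old?) + (a + a C 2)  ≤⟨ +-mono-≤ disjoint (≤-reflexive (sym ([n+1]C2≡n+nC2 a))) ⟩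
  # shadowᴸ? i (b ∷ A) + suc a C 2 ∎
  where
  open ≤-Reasoning
  a = length A
  old? = shadowᴸ? i A
  new? covered? : Decidable _
  new? y = facet? i b y ×-dec ¬? (old? y)
  covered? y = facet? i b y ×-dec old? y
  new-facets : suc i ≤ # new? + a
  new-facets = begin
    suc i                   ≤⟨ #-facet i b ∣b∣≡ ⟩
    # facet? i b            ≤⟨ count-union new? covered? (facet? i b) (allSubsets n) split ⟩
    # new? + # covered?     ≤⟨ +-monoʳ-≤ (# new?) (#-facets-in-shadow i A b∉A sizes ∣b∣≡) ⟩
    # new? + a              ∎
    where
    split : ∀ {y} → Facet i b y → _ ⊎ _
    split {y} fy with old? y
    ... | yes sh  = inj₂ (fy , sh)
    ... | no ¬sh  = inj₁ (fy , ¬sh)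
  disjoint : # new? + # old? ≤ # shadowᴸ? i (b ∷ A)
  disjoint = count-disjoint new? old? (shadowᴸ? i (b ∷ A)) (allSubsets n)
               (λ (_ , ¬sh) sh → ¬sh sh) (λ (fb , _) → here fb) there

length-filter≡count : {P : Pred X 0ℓ} (P? : Decidable P) (xs : List X) → length (filter P? xs) ≡ count P? xs
length-filter≡count P? []       = refl
length-filter≡count P? (x ∷ xs) with P? x
... | yes _ = cong suc (length-filter≡count P? xs)
... | no _  = length-filter≡count P? xs

#-shadowᴸ≤∣N∣ : ∀ i (A : List (Subset n)) → All (λ x → ∣ x ∣ ≡ suc i) A →
                # shadowᴸ? i A ≤ length (N (suc i) A)
#-shadowᴸ≤∣N∣ {n} i A sizes = begin
  # shadowᴸ? i A            ≤⟨ count-mono (shadowᴸ? i A) N? (allSubsets n)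
                                          (λ sh → level sh , facet⇒⊂ sizes sh) ⟩
  # N?                      ≡⟨ length-filter≡count N? (allSubsets n) ⟨
  length (N (suc i) A)      ∎
  where
  open ≤-Reasoning
  N? = λ y → (∣ y ∣ ≟ suc i ∸ 1) ×-dec any? (y ⊂?_) A
  level : ∀ {y} {B : List (Subset n)} → Shadowᴸ i B y → ∣ y ∣ ≡ i
  level (here (∣y∣≡ , _)) = ∣y∣≡
  level (there sh)         = level sh
  facet⇒⊂ : ∀ {y} {B : List (Subset n)} → All (λ x → ∣ x ∣ ≡ suc i) B → Shadowᴸ i B y → Any (y ⊂_) B
  facet⇒⊂ (∣x∣≡ ∷ _)     (here (∣y∣≡ , y⊆x)) =
    here (p⊆q∧∣p∣<∣q∣⇒p⊂q y⊆x (≤-reflexive (trans (cong suc ∣y∣≡) (sym ∣x∣≡))))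
  facet⇒⊂ (_    ∷ sizes) (there sh)           = there (facet⇒⊂ sizes sh)

shadow⊆shadowᴸ : ∀ {i} {A : List (Subset n)} {y} → Shadow ∅ i (_∈ᴸ A) y → Shadowᴸ i A y
shadow⊆shadowᴸ {n} {i} {y = y} (_ , ∣y∣≡ , x , x∈A , y⊆x) =
  Any.map {Q = λ z → Facet i z y} (λ { refl → trans ∣y∣≡ (cong (_+ i) (∣⊥∣≡0 n)) , y⊆x }) x∈A

neighbourhood-ratio : ∀ r i (A : List (Subset n)) → Unique A → All (λ x → ∣ x ∣ ≡ suc i) A →
                      length A ≤ (i + suc r) C suc i → suc i * length A ≤ suc r * length (N (suc i) A)
neighbourhood-ratio {n} r i A uA sizes small = begin
  suc i * length A                 ≡⟨ cong (suc i *_) (#-∈ᴸ A uA) ⟨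
  suc i * # (_∈ᴸ? A)               ≤⟨ proj₁ (shadowBound r i ∅ (_∈ᴸ? A) unif)
                                           (subst (_≤ _) (sym (#-∈ᴸ A uA)) small) ⟩
  suc r * # shadow? ∅ i (_∈ᴸ? A)   ≤⟨ *-monoʳ-≤ (suc r) (≤-trans
                                        (count-mono (shadow? ∅ i (_∈ᴸ? A)) (shadowᴸ? i A) (allSubsets n) shadow⊆shadowᴸ)
                                        (#-shadowᴸ≤∣N∣ i A sizes)) ⟩
  suc r * length (N (suc i) A)     ∎
  where
  open ≤-Reasoning
  unif : Uniform ∅ (suc i) (_∈ᴸ A)
  unif x∈A = ⊥⊆ , trans (All.lookup sizes x∈A) (cong (_+ suc i) (sym (∣⊥∣≡0 n)))

neighbourhood-bonferroni : ∀ i (A : List (Subset n)) → Unique A → All (λ x → ∣ x ∣ ≡ suc i) A →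
                           2 * suc i * length A ≤ 2 * length (N (suc i) A) + length A * length A
neighbourhood-bonferroni i A uA sizes = begin
  2 * suc i * a                    ≡⟨ *-assoc 2 (suc i) a ⟩
  2 * (suc i * a)                  ≤⟨ *-monoʳ-≤ 2 (≤-trans (bonferroni i A uA sizes)
                                                            (+-monoˡ-≤ (a C 2) (#-shadowᴸ≤∣N∣ i A sizes))) ⟩
  2 * (L + a C 2)                  ≡⟨ *-distribˡ-+ 2 L (a C 2) ⟩
  2 * L + 2 * (a C 2)              ≤⟨ +-monoʳ-≤ (2 * L) (≤-trans (m≤m+n _ a) (≤-reflexive (2*nC2+n≡n*n a))) ⟩
  2 * L + a * a                    ∎
  where
  open ≤-Reasoning
  a = length A
  L = length (N (suc i) A)

2da≤2L+a²∧4a≤d⇒7da≤8L : ∀ d a L → 2 * d * a ≤ 2 * L + a * a → 4 * a ≤ d → 7 * d * a ≤ 8 * L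
2da≤2L+a²∧4a≤d⇒7da≤8L d a L 2da≤ 4a≤d = +-cancelʳ-≤ (d * a) (7 * d * a) (8 * L) (begin
  7 * d * a + d * a      ≡⟨ regroup d a ⟩
  4 * (2 * d * a)        ≤⟨ *-monoʳ-≤ 4 2da≤ ⟩
  4 * (2 * L + a * a)    ≡⟨ expand L a ⟩
  8 * L + 4 * a * a      ≤⟨ +-monoʳ-≤ (8 * L) (*-monoˡ-≤ a 4a≤d) ⟩
  8 * L + d * a          ∎)
  where
  open ≤-Reasoning
  regroup : ∀ d a → 7 * d * a + d * a ≡ 4 * (2 * d * a)
  regroup = solve-∀
  expand : ∀ L a → 4 * (2 * L + a * a) ≡ 8 * L + 4 * a * a
  expand = solve-∀

2*[k+1]∸2≡k+k : ∀ k → 2 * suc k ∸ 2 ≡ k + k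
2*[k+1]∸2≡k+k k = trans (cong (_∸ 2) (*-suc 2 k)) (cong (k +_) (+-identityʳ k))

lemma2p10 : Σ ℕ λ d₀ → 0 < d₀ ×
    ((d : ℕ) → d₀ < d →
     (A : List (Subset (2 * d ∸ 1))) → Unique A → All (λ x → ∣ x ∣ ≡ d) A →
       ((length A ≤ d → 2 * d * length A ≤ 2 * length (N d A) + length A * length A)
        × (4 * length A ≤ d → 7 * d * length A ≤ 8 * length (N d A)))
       × (length A ≤ d ^ 6 → d * length A ≤ 9 * length (N d A))
       × (length A ≤ (2 * d ∸ 2) C d → d * length A ≤ (d ∸ 1) * length (N d A)))
-- With d = i + 1: (ii) is the case r = 8 of the shadow bound and (iii) the case r = d - 2;
-- d₀ = 200 is what makes 8! ≤ d².
lemma2p10 = 200 , s≤s z≤n , λ where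
  (suc zero) (s≤s ())
  (suc (suc j)) 200<d A uA sizes →
    let i = suc j
        part-i : 2 * suc i * length A ≤ 2 * length (N (suc i) A) + length A * length A
        part-i = neighbourhood-bonferroni i A uA sizes
        d⁶≤C : suc i ^ 6 ≤ (i + suc 8) C suc i
        d⁶≤C = subst (λ m → suc i ^ 6 ≤ m C suc i) (sym (+-suc i 8))
                 (d^6≤[d+8]Cd (suc i) (≤-trans (≤ᵇ⇒≤ (8 !) (201 * 201) _) (*-mono-≤ 200<d 200<d)))
    in ((λ _ → part-i) , 2da≤2L+a²∧4a≤d⇒7da≤8L (suc i) (length A) (length (N (suc i) A)) part-i) ,
       (λ a≤d⁶ → neighbourhood-ratio 8 i A uA sizes (≤-trans a≤d⁶ d⁶≤C)) ,
       (λ a≤C → neighbourhood-ratio j i A uA sizes (subst (λ m → length A ≤ m C suc i) (2*[k+1]∸2≡k+k i) a≤C))
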